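{- Let $n\ge k\ge 2$ be integers with $k\equiv 2$ or $3\pmod 4$, and let $G$ be a finite simple undirected graph on vertex set $[n]$. Then \[ \Phi(G) = \sum_{a=0}^{\binom{k}{2}-1}\sum_{b=0}^{k} (-1)^a\binom{n-b}{k-b}\,\phi(a,b;G). \]
   Context: $[n]=\{1,\dots,n\}$. For a graph $H$ on $[n]$, a vertex is effective if it is incident to at least one edge of $H$; $\mathbf{V}^{\mathrm{eff}}(H)$ denotes the set of effective vertices. For nonnegative integers $a,b$, $\phi(a,b;G)$ is the number of graphs $H$ on vertex set $[n]$ with $\mathbf{E}(H)\subseteq\mathbf{E}(G)$, $|\mathbf{E}(H)|=a$, and $|\mathbf{V}^{\mathrm{eff}}(H)|=b$. $\Phi(G)$ is the number of $k$-element subsets $S\subseteq[n]$ such that the induced subgraph of $G$ on $S$ is a clique or an independent set. -}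

module Defs where

open import Data.Bool using (Bool; true; false; _∧_; _∨_; not; if_then_else_)
open import Data.Nat using (ℕ; zero; suc; _+_; _∸_; _<ᵇ_; _≡ᵇ_)
open import Data.Nat.Combinatorics using (_C_)
open import Data.Integer using (ℤ; +_; -_)
import Data.Integer as ℤ
open import Data.Fin using (Fin; toℕ)
open import Data.Product using (_×_; _,_; proj₁; proj₂)
open import Data.List using (List; []; _∷_; _++_; map; length; allFin;
  cartesianProduct; upTo; foldr)
open import Relation.Binary.PropositionalEquality using (_≡_)

filterᵇ : ∀ {A : Set} → (A → Bool) → List A → List A
filterᵇ p []       = []
filterᵇ p (x ∷ xs) = if p x then x ∷ filterᵇ p xs else filterᵇ p xs

anyᵇ : ∀ {A : Set} → (A → Bool) → List A → Bool
anyᵇ p []       = false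
anyᵇ p (x ∷ xs) = p x ∨ anyᵇ p xs

allᵇ : ∀ {A : Set} → (A → Bool) → List A → Bool
allᵇ p []       = true
allᵇ p (x ∷ xs) = p x ∧ allᵇ p xs

_=ᵛ_ : ∀ {n} → Fin n → Fin n → Bool
i =ᵛ j = toℕ i ≡ᵇ toℕ j

record SimpleGraph (n : ℕ) : Set where
  field
    adj    : Fin n → Fin n → Bool
    sym    : ∀ i j → adj i j ≡ adj j i
    irrefl : ∀ i → adj i i ≡ false
open SimpleGraph public

-- All sub-lists (subsequences) of a list: for a duplicate-free list these
-- correspond bijectively to the subsets of its elements.
sublists : ∀ {A : Set} → List A → List (List A)
sublists []       = [] ∷ []
sublists (x ∷ xs) = let r = sublists xs in r ++ map (x ∷_) r

-- An edge {i,j} is represented by the pair (i , j) with i < j.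
Edge : ℕ → Set
Edge n = Fin n × Fin n

edges : ∀ {n} → SimpleGraph n → List (Edge n)
edges {n} G = filterᵇ (λ e → (toℕ (proj₁ e) <ᵇ toℕ (proj₂ e)) ∧ adj G (proj₁ e) (proj₂ e))
                      (cartesianProduct (allFin n) (allFin n))

count : ∀ {A : Set} → (A → Bool) → List A → ℕ
count p []       = 0
count p (x ∷ xs) = if p x then suc (count p xs) else count p xs

numEff : ∀ {n} → List (Edge n) → ℕ
numEff {n} H = count (λ v → anyᵇ (λ e → (proj₁ e =ᵛ v) ∨ (proj₂ e =ᵛ v)) H) (allFin n)

-- φ(a,b;G): number of graphs H on [n] with E(H) ⊆ E(G), |E(H)| = a and
-- |V^eff(H)| = b.  Such H are exactly the subsets of E(G).
φ : ∀ {n} → ℕ → ℕ → SimpleGraph n → ℕ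
φ a b G = count (λ H → (length H ≡ᵇ a) ∧ (numEff H ≡ᵇ b)) (sublists (edges G))

isClique : ∀ {n} → SimpleGraph n → List (Fin n) → Bool
isClique G S = allᵇ (λ i → allᵇ (λ j → (i =ᵛ j) ∨ adj G i j) S) S

isIndep : ∀ {n} → SimpleGraph n → List (Fin n) → Bool
isIndep G S = allᵇ (λ i → allᵇ (λ j → not (adj G i j)) S) S

Φ : ∀ {n} → ℕ → SimpleGraph n → ℕ
Φ {n} k G = count (λ S → (length S ≡ᵇ k) ∧ (isClique G S ∨ isIndep G S)) (sublists (allFin n))

sumℤ : ℕ → (ℕ → ℤ) → ℤ
sumℤ m f = foldr ℤ._+_ (+ 0) (map f (upTo m))

sign : ℕ → ℤ
sign zero    = + 1
sign (suc a) = - sign a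

rhs : ∀ {n} → ℕ → SimpleGraph n → ℤ
rhs {n} k G = sumℤ (k C 2) (λ a → sumℤ (suc k) (λ b →
  sign a ℤ.* + (((n ∸ b) C (k ∸ b)) Data.Nat.* φ a b G)))

{-# OPTIONS --safe #-}

-- Weight a graph H ⊆ E(G) by (-1)^|H| if |H| < K = C(k,2) and by 0 otherwise,
-- and sum these weights over all pairs (S, H) in which S is a k-set of vertices
-- containing every effective vertex of H. For fixed H with b effective vertices
-- there are C(n-b, k-b) such sets S, which gives the right-hand side. For fixed S
-- the admissible H are the subgraphs of G[S]; if G[S] has e edges, their weights
-- add up to Σ_{j<K} (-1)^j C(e,j), which is 1 for e = 0, 0 for 0 < e < K and
-- -(-1)^K for e = K. Since k ≡ 2, 3 (mod 4) exactly when K is odd, the total is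
-- 1 precisely when S is a clique or an independent set.

module Submission where

open import Defs hiding (sym)
import Algebra.Properties.CommutativeSemigroup as CommutativeSemigroupProperties
open import Algebra.Bundles using (CommutativeMonoid)
open import Data.Bool using (Bool; true; false; _∧_; _∨_; not; if_then_else_)
open import Data.Bool.Properties
  using (T-≡; ⇔→≡; ¬-not; not-injective; ∨-zeroʳ; ∨-identityʳ; ∧-zeroʳ; ∧-commutativeMonoid)
open import Data.Empty using (⊥-elim)
open import Data.Fin as Fin using (Fin; toℕ)
open import Data.Fin.Properties using (toℕ-injective)
open import Data.Integer using (ℤ; +_; -_; _+_; _*_; _-_; 0ℤ; 1ℤ; -1ℤ)
import Data.Integer.Properties as ℤₚ
open import Data.List using (List; []; _∷_; _++_; map; length; foldr; upTo; allFin; cartesianProduct)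
open import Data.List.Properties using (map-∘; map-applyUpTo; length-tabulate)
open import Data.List.Membership.Propositional using (_∈_; _∉_)
open import Data.List.Membership.Propositional.Properties
  using (∈-++⁻; ∈-map⁻; ∈-allFin; ∈-cartesianProduct⁺)
open import Data.List.Relation.Binary.Sublist.Propositional using (_⊆_; []; _∷_; _∷ʳ_)
open import Data.List.Relation.Binary.Sublist.Propositional.Properties using (All-resp-⊆)
open import Data.List.Relation.Unary.All using (All; []; _∷_)
import Data.List.Relation.Unary.All as All
open import Data.List.Relation.Unary.All.Properties using (All¬⇒¬Any)
open import Data.List.Relation.Unary.AllPairs using (AllPairs; []; _∷_)
import Data.List.Relation.Unary.AllPairs.Properties as AllPairs
open import Data.List.Relation.Unary.Any using (Any; here; there)
import Data.List.Relation.Unary.Any as Any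
open import Data.List.Relation.Unary.Unique.Propositional using (Unique)
import Data.List.Relation.Unary.Unique.Propositional.Properties as Unique
open import Data.Nat as ℕ using (ℕ; zero; suc; _≤_; _<_; z≤n; s≤s; _≡ᵇ_; _<ᵇ_; _∸_; _%_)
import Data.Nat.Properties as ℕₚ
open import Data.Nat.Combinatorics using (_C_; nC1≡n; nCk+nC[k+1]≡[n+1]C[k+1])
open import Data.Product using (_×_; _,_; proj₁; proj₂)
open import Data.Sum using (_⊎_; inj₁; inj₂)
open import Function using (_∘_; _⇔_; mk⇔; Equivalence)
open import Relation.Binary.Definitions using (tri<; tri≈; tri>)
open import Relation.Binary.PropositionalEquality
  using (_≡_; _≢_; refl; sym; trans; cong; cong₂; subst; subst₂; module ≡-Reasoning)
open import Relation.Nullary.Decidable using (dec-true; dec-false)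
open import Relation.Nullary.Negation using (¬_)

private
  variable
    A B : Set
    n : ℕ

∧≡true⇒ : ∀ {a b} → (a ∧ b) ≡ true → a ≡ true × b ≡ true
∧≡true⇒ {true} b≡true = refl , b≡true

∨≡true⇒ : ∀ {a b} → (a ∨ b) ≡ true → a ≡ true ⊎ b ≡ true
∨≡true⇒ {true}  _      = inj₁ refl
∨≡true⇒ {false} b≡true = inj₂ b≡true

≡ᵇ⇒≡ : ∀ {m n} → (m ≡ᵇ n) ≡ true → m ≡ n
≡ᵇ⇒≡ {m} {n} eq = ℕₚ.≡ᵇ⇒≡ m n (Equivalence.from T-≡ eq)

=ᵛ-refl : (i : Fin n) → (i =ᵛ i) ≡ true
=ᵛ-refl i = dec-true (toℕ i ℕₚ.≟ toℕ i) refl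

=ᵛ⇒≡ : {i j : Fin n} → (i =ᵛ j) ≡ true → i ≡ j
=ᵛ⇒≡ eq = toℕ-injective (≡ᵇ⇒≡ eq)

≢⇒=ᵛ-false : {i j : Fin n} → i ≢ j → (i =ᵛ j) ≡ false
≢⇒=ᵛ-false i≢j = dec-false (toℕ _ ℕₚ.≟ toℕ _) (i≢j ∘ toℕ-injective)

=ᵛ-sym : (i j : Fin n) → (i =ᵛ j) ≡ (j =ᵛ i)
=ᵛ-sym i j = ⇔→≡ (mk⇔ (flip {i = i} {j}) (flip {i = j} {i}))
  where
  flip : ∀ {i j : Fin n} → (i =ᵛ j) ≡ true → (j =ᵛ i) ≡ true
  flip {i = i} {j} i=j with refl ← =ᵛ⇒≡ {i = i} {j} i=j = i=j

allᵇ⇒All : (p : A → Bool) (xs : List A) → allᵇ p xs ≡ true → All (λ x → p x ≡ true) xs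
allᵇ⇒All p []       _   = []
allᵇ⇒All p (x ∷ xs) all with p x in px
... | true = px ∷ allᵇ⇒All p xs all

All⇒allᵇ : (p : A → Bool) (xs : List A) → All (λ x → p x ≡ true) xs → allᵇ p xs ≡ true
All⇒allᵇ p []       []         = refl
All⇒allᵇ p (x ∷ xs) (px ∷ pxs) rewrite px = All⇒allᵇ p xs pxs

anyᵇ⇒Any : (p : A → Bool) (xs : List A) → anyᵇ p xs ≡ true → Any (λ x → p x ≡ true) xs
anyᵇ⇒Any p (x ∷ xs) any with p x in px
... | true  = here px
... | false = there (anyᵇ⇒Any p xs any)

Any⇒anyᵇ : (p : A → Bool) (xs : List A) → Any (λ x → p x ≡ true) xs → anyᵇ p xs ≡ true
Any⇒anyᵇ p (x ∷ xs) (here px)   rewrite px = refl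
Any⇒anyᵇ p (x ∷ xs) (there pxs) rewrite Any⇒anyᵇ p xs pxs = ∨-zeroʳ (p x)

allᵇ-cong : {p q : A → Bool} (xs : List A) → (∀ {x} → x ∈ xs → p x ≡ q x) → allᵇ p xs ≡ allᵇ q xs
allᵇ-cong []       p≗q = refl
allᵇ-cong (x ∷ xs) p≗q = cong₂ _∧_ (p≗q (here refl)) (allᵇ-cong xs (p≗q ∘ there))

_∈ᵇ_ : Fin n → List (Fin n) → Bool
v ∈ᵇ S = anyᵇ (_=ᵛ v) S

∈ᵇ⇒∈ : {v : Fin n} (S : List (Fin n)) → (v ∈ᵇ S) ≡ true → v ∈ S
∈ᵇ⇒∈ {v = v} S = Any.map (sym ∘ =ᵛ⇒≡) ∘ anyᵇ⇒Any (_=ᵛ v) S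

∈⇒∈ᵇ : {v : Fin n} (S : List (Fin n)) → v ∈ S → (v ∈ᵇ S) ≡ true
∈⇒∈ᵇ {v = v} S = Any⇒anyᵇ (_=ᵛ v) S ∘ Any.map λ { refl → =ᵛ-refl v }

∉⇒∈ᵇ≡false : {v : Fin n} (S : List (Fin n)) → v ∉ S → (v ∈ᵇ S) ≡ false
∉⇒∈ᵇ≡false S v∉S = ¬-not (v∉S ∘ ∈ᵇ⇒∈ S)

∈ᵇ-∷-≢ : {u v : Fin n} (S : List (Fin n)) → u ≢ v → (v ∈ᵇ (u ∷ S)) ≡ (v ∈ᵇ S)
∈ᵇ-∷-≢ {v = v} S u≢v = cong (_∨ (v ∈ᵇ S)) (≢⇒=ᵛ-false u≢v)

∑ : (A → ℤ) → List A → ℤ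
∑ f xs = foldr _+_ 0ℤ (map f xs)

∑-++ : (f : A → ℤ) (xs ys : List A) → ∑ f (xs ++ ys) ≡ ∑ f xs + ∑ f ys
∑-++ f []       ys = sym (ℤₚ.+-identityˡ _)
∑-++ f (x ∷ xs) ys = trans (cong (_+_ (f x)) (∑-++ f xs ys)) (sym (ℤₚ.+-assoc (f x) _ _))

∑-map : (f : B → ℤ) (g : A → B) (xs : List A) → ∑ f (map g xs) ≡ ∑ (f ∘ g) xs
∑-map f g xs = cong (foldr _+_ 0ℤ) (sym (map-∘ xs))

∑-cong : {f g : A → ℤ} (xs : List A) → (∀ {x} → x ∈ xs → f x ≡ g x) → ∑ f xs ≡ ∑ g xs
∑-cong []       f≗g = refl
∑-cong (x ∷ xs) f≗g = cong₂ _+_ (f≗g (here refl)) (∑-cong xs (f≗g ∘ there))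

∑-zero : (xs : List A) → ∑ (λ _ → 0ℤ) xs ≡ 0ℤ
∑-zero []       = refl
∑-zero (x ∷ xs) = trans (ℤₚ.+-identityˡ _) (∑-zero xs)

∑-distrib-+ : (f g : A → ℤ) (xs : List A) → ∑ (λ x → f x + g x) xs ≡ ∑ f xs + ∑ g xs
∑-distrib-+ f g []       = refl
∑-distrib-+ f g (x ∷ xs) =
  trans (cong (_+_ (f x + g x)) (∑-distrib-+ f g xs)) (interchange (f x) (g x) _ _)
  where open CommutativeSemigroupProperties ℤₚ.+-commutativeSemigroup using (interchange)

neg-distrib-∑ : (f : A → ℤ) (xs : List A) → - ∑ f xs ≡ ∑ (λ x → - f x) xs
neg-distrib-∑ f []       = refl
neg-distrib-∑ f (x ∷ xs) =
  trans (ℤₚ.neg-distrib-+ (f x) _) (cong (_+_ (- f x)) (neg-distrib-∑ f xs))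

∑-comm : (h : A → B → ℤ) (xs : List A) (ys : List B) →
         ∑ (λ x → ∑ (h x) ys) xs ≡ ∑ (λ y → ∑ (λ x → h x y) xs) ys
∑-comm h []       ys = sym (∑-zero ys)
∑-comm h (x ∷ xs) ys =
  trans (cong (_+_ (∑ (h x) ys)) (∑-comm h xs ys)) (sym (∑-distrib-+ (h x) _ ys))

∑-count : (c : ℤ) (p : A → Bool) (xs : List A) →
          ∑ (λ x → if p x then c else 0ℤ) xs ≡ c * + count p xs
∑-count c p []       = sym (ℤₚ.*-zeroʳ c)
∑-count c p (x ∷ xs) with p x
... | true  = begin
  c + ∑ (λ x → if p x then c else 0ℤ) xs ≡⟨ cong (_+_ c) (∑-count c p xs) ⟩
  c + c * + count p xs                   ≡⟨ cong (_+ c * + count p xs) (ℤₚ.*-identityʳ c) ⟨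
  c * 1ℤ + c * + count p xs              ≡⟨ ℤₚ.*-distribˡ-+ c 1ℤ _ ⟨
  c * + suc (count p xs)                 ∎
  where open ≡-Reasoning
... | false = trans (ℤₚ.+-identityˡ _) (∑-count c p xs)

∑-guard : ∀ b (p : A → Bool) (f : A → ℤ) xs →
  ∑ (λ x → if b ∧ p x then f x else 0ℤ) xs ≡ (if b then ∑ (λ x → if p x then f x else 0ℤ) xs else 0ℤ)
∑-guard true  p f xs = refl
∑-guard false p f xs = ∑-zero xs

∑-upTo-suc : ∀ m (f : ℕ → ℤ) → ∑ f (upTo (suc m)) ≡ f 0 + ∑ (f ∘ suc) (upTo m)
∑-upTo-suc m f =
  cong (_+_ (f 0)) (trans (cong (∑ f) (sym (map-applyUpTo (λ i → i) suc m))) (∑-map f suc (upTo m)))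

∑-upTo-select : ∀ m x (g : ℕ → ℤ) →
  ∑ (λ a → if x ≡ᵇ a then g a else 0ℤ) (upTo m) ≡ (if x <ᵇ m then g x else 0ℤ)
∑-upTo-select zero    x       g = refl
∑-upTo-select (suc m) zero    g =
  trans (∑-upTo-suc m (λ a → if 0 ≡ᵇ a then g a else 0ℤ))
        (trans (cong (_+_ (g 0)) (∑-zero (upTo m))) (ℤₚ.+-identityʳ (g 0)))
∑-upTo-select (suc m) (suc x) g =
  trans (∑-upTo-suc m (λ a → if suc x ≡ᵇ a then g a else 0ℤ))
        (trans (ℤₚ.+-identityˡ _) (∑-upTo-select m x (g ∘ suc)))

∑-upTo-select₂ : ∀ m m′ x y (g : ℕ → ℕ → ℤ) →
  ∑ (λ a → ∑ (λ b → if (x ≡ᵇ a) ∧ (y ≡ᵇ b) then g a b else 0ℤ) (upTo m′)) (upTo m)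
    ≡ (if x <ᵇ m then (if y <ᵇ m′ then g x y else 0ℤ) else 0ℤ)
∑-upTo-select₂ m m′ x y g = begin
  ∑ (λ a → ∑ (λ b → if (x ≡ᵇ a) ∧ (y ≡ᵇ b) then g a b else 0ℤ) (upTo m′)) (upTo m)
    ≡⟨ ∑-cong (upTo m) (λ {a} _ → ∑-guard (x ≡ᵇ a) (y ≡ᵇ_) (g a) (upTo m′)) ⟩
  ∑ (λ a → if x ≡ᵇ a then ∑ (λ b → if y ≡ᵇ b then g a b else 0ℤ) (upTo m′) else 0ℤ) (upTo m)
    ≡⟨ ∑-cong (upTo m) (λ {a} _ → cong (λ s → if x ≡ᵇ a then s else 0ℤ)
                                        (∑-upTo-select m′ y (g a))) ⟩
  ∑ (λ a → if x ≡ᵇ a then (if y <ᵇ m′ then g a y else 0ℤ) else 0ℤ) (upTo m)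
    ≡⟨ ∑-upTo-select m x (λ a → if y <ᵇ m′ then g a y else 0ℤ) ⟩
  (if x <ᵇ m then (if y <ᵇ m′ then g x y else 0ℤ) else 0ℤ) ∎
  where open ≡-Reasoning

nested-if≡product : ∀ b c (s : ℤ) m →
  (if b then (if c then s * + m else 0ℤ) else 0ℤ) ≡ (if b then s else 0ℤ) * + (if c then m else 0)
nested-if≡product true  true  s m = refl
nested-if≡product true  false s m = sym (ℤₚ.*-zeroʳ s)
nested-if≡product false c     s m = refl

count-++ : (p : A → Bool) (xs ys : List A) → count p (xs ++ ys) ≡ count p xs ℕ.+ count p ys
count-++ p []       ys = refl
count-++ p (x ∷ xs) ys with p x
... | true  = cong suc (count-++ p xs ys)
... | false = count-++ p xs ys

count-map : (p : B → Bool) (f : A → B) (xs : List A) → count p (map f xs) ≡ count (p ∘ f) xs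
count-map p f []       = refl
count-map p f (x ∷ xs) with p (f x)
... | true  = cong suc (count-map p f xs)
... | false = count-map p f xs

count-cong : {p q : A → Bool} (xs : List A) → (∀ {x} → x ∈ xs → p x ≡ q x) → count p xs ≡ count q xs
count-cong           []       p≗q = refl
count-cong {q = q} (x ∷ xs) p≗q rewrite p≗q (here refl) with q x
... | true  = cong suc (count-cong xs (p≗q ∘ there))
... | false = count-cong xs (p≗q ∘ there)

count-≡0 : (p : A → Bool) (xs : List A) → (∀ {x} → x ∈ xs → p x ≡ false) → count p xs ≡ 0
count-≡0 p []       _  = refl
count-≡0 p (x ∷ xs) ¬p rewrite ¬p (here refl) = count-≡0 p xs (¬p ∘ there)

count-≤-length : (p : A → Bool) (xs : List A) → count p xs ≤ length xs
count-≤-length p []       = z≤n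
count-≤-length p (x ∷ xs) with p x
... | true  = s≤s (count-≤-length p xs)
... | false = ℕₚ.m≤n⇒m≤1+n (count-≤-length p xs)

length-filterᵇ : (p : A → Bool) (xs : List A) → length (filterᵇ p xs) ≡ count p xs
length-filterᵇ p []       = refl
length-filterᵇ p (x ∷ xs) with p x
... | true  = cong suc (length-filterᵇ p xs)
... | false = length-filterᵇ p xs

count-filterᵇ : (p q : A → Bool) (xs : List A) → count q (filterᵇ p xs) ≡ count (λ x → p x ∧ q x) xs
count-filterᵇ p q []       = refl
count-filterᵇ p q (x ∷ xs) with p x
... | false = count-filterᵇ p q xs
... | true with q x
...   | true  = cong suc (count-filterᵇ p q xs)
...   | false = count-filterᵇ p q xs

module _ (p q : A → Bool) where

  count-∧-≤ : (xs : List A) → count (λ x → p x ∧ q x) xs ≤ count p xs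
  count-∧-≤ []       = z≤n
  count-∧-≤ (x ∷ xs) with p x | q x
  ... | true  | true  = s≤s (count-∧-≤ xs)
  ... | true  | false = ℕₚ.m≤n⇒m≤1+n (count-∧-≤ xs)
  ... | false | _     = count-∧-≤ xs

  count-∧≡count⇔ : (xs : List A) →
    count (λ x → p x ∧ q x) xs ≡ count p xs ⇔ (∀ {x} → x ∈ xs → p x ≡ true → q x ≡ true)
  count-∧≡count⇔ xs = mk⇔ (to xs) (from xs)
    where
    count-∧≢suc : ∀ xs → count (λ x → p x ∧ q x) xs ≢ suc (count p xs)
    count-∧≢suc xs eq = ℕₚ.<-irrefl refl (subst (ℕ._≤ count p xs) eq (count-∧-≤ xs))
    to : ∀ xs → count (λ x → p x ∧ q x) xs ≡ count p xs →
         ∀ {x} → x ∈ xs → p x ≡ true → q x ≡ true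
    to (y ∷ ys) eq (here refl) py with p y | q y
    ... | true  | true  = refl
    ... | true  | false = ⊥-elim (count-∧≢suc ys eq)
    to (y ∷ ys) eq (there x∈ys) px with p y | q y
    ... | true  | true  = to ys (ℕₚ.suc-injective eq) x∈ys px
    ... | true  | false = ⊥-elim (count-∧≢suc ys eq)
    ... | false | _     = to ys eq x∈ys px
    from : ∀ xs → (∀ {x} → x ∈ xs → p x ≡ true → q x ≡ true) →
           count (λ x → p x ∧ q x) xs ≡ count p xs
    from []       _   = refl
    from (y ∷ ys) p⇒q with p y in py | q y in qy
    ... | true  | true  = cong suc (from ys (p⇒q ∘ there))
    ... | true  | false with () ← trans (sym qy) (p⇒q (here refl) py)
    ... | false | _     = from ys (p⇒q ∘ there)

  count-∧≡0⇔ : (xs : List A) →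
    count (λ x → p x ∧ q x) xs ≡ 0 ⇔ (∀ {x} → x ∈ xs → p x ≡ true → q x ≡ false)
  count-∧≡0⇔ xs = mk⇔ (to xs) (λ p⇒¬q → count-≡0 _ xs (λ x∈ → ∧≡false (p⇒¬q x∈)))
    where
    ∧≡false : ∀ {x} → (p x ≡ true → q x ≡ false) → (p x ∧ q x) ≡ false
    ∧≡false {x} p⇒¬q with p x
    ... | true  = p⇒¬q refl
    ... | false = refl
    to : ∀ xs → count (λ x → p x ∧ q x) xs ≡ 0 → ∀ {x} → x ∈ xs → p x ≡ true → q x ≡ false
    to (y ∷ ys) eq (here refl) py with p y | q y
    ... | true  | false = refl
    to (y ∷ ys) eq (there x∈ys) px with p y | q y
    ... | true  | false = to ys eq x∈ys px
    ... | false | _     = to ys eq x∈ys px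

-- Sublists and truncated alternating sums

∈-sublists⇒⊆ : (L : List A) {S : List A} → S ∈ sublists L → S ⊆ L
∈-sublists⇒⊆ []      (here refl) = []
∈-sublists⇒⊆ (x ∷ L) S∈ with ∈-++⁻ (sublists L) S∈
... | inj₁ S∈L = x ∷ʳ ∈-sublists⇒⊆ L S∈L
... | inj₂ S∈x∷L with ∈-map⁻ (x ∷_) S∈x∷L
...   | _ , S∈L , refl = refl ∷ ∈-sublists⇒⊆ L S∈L

count-sublists-∷ : (p : List A → Bool) (x : A) (xs : List A) →
  count p (sublists (x ∷ xs)) ≡ count p (sublists xs) ℕ.+ count (p ∘ (x ∷_)) (sublists xs)
count-sublists-∷ p x xs =
  trans (count-++ p (sublists xs) _) (cong (count p (sublists xs) ℕ.+_) (count-map p (x ∷_) (sublists xs)))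

∑-sublists-∷ : (f : List A → ℤ) (x : A) (xs : List A) →
  ∑ f (sublists (x ∷ xs)) ≡ ∑ f (sublists xs) + ∑ (f ∘ (x ∷_)) (sublists xs)
∑-sublists-∷ f x xs =
  trans (∑-++ f (sublists xs) _) (cong (_+_ (∑ f (sublists xs))) (∑-map f (x ∷_) (sublists xs)))

∑-sublists-filterᵇ : (q : A → Bool) (f : List A → ℤ) (L : List A) →
  ∑ (λ H → if allᵇ q H then f H else 0ℤ) (sublists L) ≡ ∑ f (sublists (filterᵇ q L))
∑-sublists-filterᵇ q f []       = refl
∑-sublists-filterᵇ q f (x ∷ xs) = begin
  ∑ g (sublists (x ∷ xs))
    ≡⟨ ∑-sublists-∷ g x xs ⟩
  ∑ g (sublists xs) + ∑ (g ∘ (x ∷_)) (sublists xs)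
    ≡⟨ cong₂ _+_ (∑-sublists-filterᵇ q f xs) (∑-guard (q x) (allᵇ q) (f ∘ (x ∷_)) (sublists xs)) ⟩
  ∑ f (sublists xs′) + (if q x then ∑ (λ H → if allᵇ q H then f (x ∷ H) else 0ℤ) (sublists xs) else 0ℤ)
    ≡⟨ keep-or-drop (q x) ⟩
  ∑ f (sublists (filterᵇ q (x ∷ xs))) ∎
  where
  open ≡-Reasoning
  g = λ H → if allᵇ q H then f H else 0ℤ
  xs′ = filterᵇ q xs
  keep-or-drop : ∀ b →
    ∑ f (sublists xs′) + (if b then ∑ (λ H → if allᵇ q H then f (x ∷ H) else 0ℤ) (sublists xs) else 0ℤ)
      ≡ ∑ f (sublists (if b then x ∷ xs′ else xs′))
  keep-or-drop true  = trans (cong (_+_ (∑ f (sublists xs′))) (∑-sublists-filterᵇ q (f ∘ (x ∷_)) xs))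
                             (sym (∑-sublists-∷ f x xs′))
  keep-or-drop false = ℤₚ.+-identityʳ _

truncatedSign : ℕ → ℕ → ℤ
truncatedSign K ℓ = if ℓ <ᵇ K then sign ℓ else 0ℤ

-- alternating K e = Σ_{j<K} (-1)^j C(e,j), computed by Pascal's rule in e.
alternating : ℕ → ℕ → ℤ
alternating zero    e       = 0ℤ
alternating (suc K) zero    = 1ℤ
alternating (suc K) (suc e) = alternating (suc K) e - alternating K e

∑-sublists-truncatedSign : ∀ K (L : List A) →
  ∑ (truncatedSign K ∘ length) (sublists L) ≡ alternating K (length L)
∑-sublists-truncatedSign zero    L        = ∑-zero (sublists L)
∑-sublists-truncatedSign (suc K) []       = refl
∑-sublists-truncatedSign (suc K) (x ∷ xs) = begin
  ∑ (truncatedSign (suc K) ∘ length) (sublists (x ∷ xs))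
    ≡⟨ ∑-sublists-∷ (truncatedSign (suc K) ∘ length) x xs ⟩
  ∑ (truncatedSign (suc K) ∘ length) (sublists xs) + ∑ (truncatedSign (suc K) ∘ suc ∘ length) (sublists xs)
    ≡⟨ cong₂ _+_ (∑-sublists-truncatedSign (suc K) xs)
                 (∑-cong (sublists xs) (λ {H} _ → truncatedSign-suc (length H))) ⟩
  alternating (suc K) (length xs) + ∑ (λ H → - truncatedSign K (length H)) (sublists xs)
    ≡⟨ cong (_+_ (alternating (suc K) (length xs))) (neg-distrib-∑ (truncatedSign K ∘ length) (sublists xs)) ⟨
  alternating (suc K) (length xs) - ∑ (truncatedSign K ∘ length) (sublists xs)
    ≡⟨ cong (_-_ (alternating (suc K) (length xs))) (∑-sublists-truncatedSign K xs) ⟩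
  alternating (suc K) (length xs) - alternating K (length xs) ∎
  where
  open ≡-Reasoning
  truncatedSign-suc : ∀ ℓ → truncatedSign (suc K) (suc ℓ) ≡ - truncatedSign K ℓ
  truncatedSign-suc ℓ with ℓ <ᵇ K
  ... | true  = refl
  ... | false = refl

alternating-vanishes : ∀ K e → 0 < e → e < K → alternating K e ≡ 0ℤ
alternating-vanishes (suc (suc K)) (suc zero)    _ _           = refl
alternating-vanishes (suc K)       (suc (suc e)) _ (s≤s e+1<K) =
  cong₂ _-_ (alternating-vanishes (suc K) (suc e) (s≤s z≤n) (ℕₚ.m<n⇒m<1+n e+1<K))
            (alternating-vanishes K (suc e) (s≤s z≤n) e+1<K)
alternating-vanishes (suc zero)    (suc zero)    _ (s≤s ())

alternating-diagonal : ∀ K → alternating (suc K) (suc K) ≡ sign K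
alternating-diagonal zero    = refl
alternating-diagonal (suc K) =
  trans (cong₂ _-_ (alternating-vanishes (suc (suc K)) (suc K) (s≤s z≤n) (ℕₚ.n<1+n _))
                   (alternating-diagonal K))
        (ℤₚ.+-identityˡ _)

alternating-odd : ∀ {K e} → sign K ≡ -1ℤ → e ≤ K →
  alternating K e ≡ (if (e ≡ᵇ K) ∨ (e ≡ᵇ 0) then 1ℤ else 0ℤ)
alternating-odd {zero}  ()
alternating-odd {suc K} {zero}  _ _ = refl
alternating-odd {suc K} {suc e} odd e≤K with ℕₚ.m≤n⇒m<n∨m≡n e≤K
... | inj₁ e<K rewrite dec-false (suc e ℕₚ.≟ suc K) (ℕₚ.<⇒≢ e<K) =
  alternating-vanishes (suc K) (suc e) (s≤s z≤n) e<K
... | inj₂ refl rewrite dec-true (e ℕₚ.≟ e) refl =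
  trans (alternating-diagonal e) (trans (sym (ℤₚ.neg-involutive _)) (cong -_ odd))

-- Parity of k C 2

sign-+-twice : ∀ m c → sign (m ℕ.+ (m ℕ.+ c)) ≡ sign c
sign-+-twice zero    c = refl
sign-+-twice (suc m) c = begin
  - sign (m ℕ.+ suc (m ℕ.+ c))   ≡⟨ cong (-_ ∘ sign) (ℕₚ.+-suc m (m ℕ.+ c)) ⟩
  - - sign (m ℕ.+ (m ℕ.+ c))     ≡⟨ ℤₚ.neg-involutive _ ⟩
  sign (m ℕ.+ (m ℕ.+ c))         ≡⟨ sign-+-twice m c ⟩
  sign c                         ∎
  where open ≡-Reasoning

suc-C2 : ∀ m → suc m C 2 ≡ m ℕ.+ m C 2
suc-C2 m = trans (sym (nCk+nC[k+1]≡[n+1]C[k+1] m 1)) (cong (ℕ._+ m C 2) (nC1≡n m))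

sign-C2-+2 : ∀ m → sign (suc (suc m) C 2) ≡ - sign (m C 2)
sign-C2-+2 m = begin
  sign (suc (suc m) C 2)            ≡⟨ cong sign (suc-C2 (suc m)) ⟩
  sign (suc m ℕ.+ suc m C 2)        ≡⟨ cong (λ c → sign (suc m ℕ.+ c)) (suc-C2 m) ⟩
  - sign (m ℕ.+ (m ℕ.+ m C 2))      ≡⟨ cong -_ (sign-+-twice m (m C 2)) ⟩
  - sign (m C 2)                    ∎
  where open ≡-Reasoning

sign-C2 : ∀ k → k % 4 ≡ 2 ⊎ k % 4 ≡ 3 → sign (k C 2) ≡ -1ℤ
sign-C2 0 (inj₁ ())
sign-C2 0 (inj₂ ())
sign-C2 1 (inj₁ ())
sign-C2 1 (inj₂ ())
sign-C2 2 _ = refl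
sign-C2 3 _ = refl
sign-C2 (suc (suc (suc (suc k)))) k%4 = begin
  sign ((4 ℕ.+ k) C 2)     ≡⟨ sign-C2-+2 (suc (suc k)) ⟩
  - sign ((2 ℕ.+ k) C 2)   ≡⟨ cong -_ (sign-C2-+2 k) ⟩
  - - sign (k C 2)         ≡⟨ ℤₚ.neg-involutive _ ⟩
  sign (k C 2)             ≡⟨ sign-C2 k k%4 ⟩
  -1ℤ                      ∎
  where open ≡-Reasoning

-- k-sets containing a given set of vertices

containsMarked : (Fin n → Bool) → List (Fin n) → List (Fin n) → Bool
containsMarked t L S = allᵇ (λ v → not (t v) ∨ (v ∈ᵇ S)) L

containsMarked-∉ : (t : Fin n → Bool) {x : Fin n} (xs S : List (Fin n)) → x ∉ S →
  containsMarked t (x ∷ xs) S ≡ not (t x) ∧ containsMarked t xs S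
containsMarked-∉ t {x} xs S x∉S =
  cong (_∧ containsMarked t xs S) (trans (cong (not (t x) ∨_) (∉⇒∈ᵇ≡false S x∉S)) (∨-identityʳ _))

containsMarked-∷ : (t : Fin n → Bool) {x : Fin n} {xs : List (Fin n)} (S : List (Fin n)) →
  All (x ≢_) xs → containsMarked t (x ∷ xs) (x ∷ S) ≡ containsMarked t xs S
containsMarked-∷ t {x} {xs} S x∉xs rewrite =ᵛ-refl x | ∨-zeroʳ (not (t x)) =
  allᵇ-cong xs (λ v∈xs → cong (not (t _) ∨_) (∈ᵇ-∷-≢ S (All.lookup x∉xs v∈xs)))

count-∈ᵇ : {S L : List (Fin n)} → Unique L → S ⊆ L → count (_∈ᵇ S) L ≡ length S
count-∈ᵇ                []         []             = refl
count-∈ᵇ {S = S}       (x∉xs ∷ u) (x ∷ʳ S⊆xs)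
  rewrite ∉⇒∈ᵇ≡false S (All¬⇒¬Any (All-resp-⊆ S⊆xs x∉xs)) = count-∈ᵇ u S⊆xs
count-∈ᵇ {S = x ∷ S} (x∉xs ∷ u) (refl ∷ S⊆xs) rewrite =ᵛ-refl x =
  cong suc (trans (count-cong _ (λ v∈xs → ∈ᵇ-∷-≢ S (All.lookup x∉xs v∈xs))) (count-∈ᵇ u S⊆xs))

-- The number of k-subsets of an m-set that contain a fixed c-subset.
nSupersets : ℕ → ℕ → ℕ → ℕ
nSupersets m c k = if c <ᵇ suc k then (m ∸ c) C (k ∸ c) else 0

nSupersets-suc-0 : ∀ m c → nSupersets (suc m) c 0 ≡ nSupersets m c 0
nSupersets-suc-0 m zero    = refl
nSupersets-suc-0 m (suc c) = refl

nSupersets-suc : ∀ {m c} k → c ≤ m →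
  nSupersets (suc m) c (suc k) ≡ nSupersets m c (suc k) ℕ.+ nSupersets m c k
nSupersets-suc {m}     {zero}  k       _         =
  trans (sym (nCk+nC[k+1]≡[n+1]C[k+1] m k)) (ℕₚ.+-comm (m C k) _)
nSupersets-suc {suc m} {suc c} zero    (s≤s c≤m) = trans (nSupersets-suc-0 m c) (sym (ℕₚ.+-identityʳ _))
nSupersets-suc {suc m} {suc c} (suc k) (s≤s c≤m) = nSupersets-suc k c≤m

count-supersets : (t : Fin n → Bool) {L : List (Fin n)} → Unique L → ∀ k →
  count (λ S → (length S ≡ᵇ k) ∧ containsMarked t L S) (sublists L) ≡ nSupersets (length L) (count t L) k
count-supersets t []                 zero    = refl
count-supersets t []                 (suc k) = refl
count-supersets t {x ∷ xs} (x∉xs ∷ u) k = begin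
  count P (sublists (x ∷ xs))
    ≡⟨ count-sublists-∷ P x xs ⟩
  count P (sublists xs) ℕ.+ count (P ∘ (x ∷_)) (sublists xs)
    ≡⟨ cong₂ ℕ._+_ (count-cong (sublists xs) without-x) (count-cong (sublists xs) (λ {S} _ → with-x S)) ⟩
  count (λ S → (length S ≡ᵇ k) ∧ (not (t x) ∧ Q S)) (sublists xs)
    ℕ.+ count (λ S → (suc (length S) ≡ᵇ k) ∧ Q S) (sublists xs)
    ≡⟨ by-mark (t x) refl k ⟩
  nSupersets (suc (length xs)) (count t (x ∷ xs)) k ∎
  where
  open ≡-Reasoning
  P = λ S → (length S ≡ᵇ k) ∧ containsMarked t (x ∷ xs) S
  Q = containsMarked t xs
  without-x : ∀ {S} → S ∈ sublists xs → P S ≡ (length S ≡ᵇ k) ∧ (not (t x) ∧ Q S)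
  without-x {S} S∈ = cong ((length S ≡ᵇ k) ∧_)
    (containsMarked-∉ t xs S (All¬⇒¬Any (All-resp-⊆ (∈-sublists⇒⊆ xs S∈) x∉xs)))
  with-x : ∀ S → P (x ∷ S) ≡ (suc (length S) ≡ᵇ k) ∧ Q S
  with-x S = cong ((suc (length S) ≡ᵇ k) ∧_) (containsMarked-∷ t S x∉xs)
  by-mark : ∀ b → t x ≡ b → ∀ k →
    count (λ S → (length S ≡ᵇ k) ∧ (not b ∧ Q S)) (sublists xs)
      ℕ.+ count (λ S → (suc (length S) ≡ᵇ k) ∧ Q S) (sublists xs)
      ≡ nSupersets (suc (length xs)) (count t (x ∷ xs)) k
  by-mark true  tx zero    rewrite tx =
    cong₂ ℕ._+_ (count-≡0 _ (sublists xs) (λ {S} _ → ∧-zeroʳ (length S ≡ᵇ 0)))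
                (count-≡0 _ (sublists xs) (λ _ → refl))
  by-mark true  tx (suc k) rewrite tx =
    cong₂ ℕ._+_ (count-≡0 _ (sublists xs) (λ {S} _ → ∧-zeroʳ (length S ≡ᵇ suc k)))
                (count-supersets t u k)
  by-mark false tx zero    rewrite tx =
    trans (cong₂ ℕ._+_ (count-supersets t u 0) (count-≡0 _ (sublists xs) (λ _ → refl)))
          (trans (ℕₚ.+-identityʳ _) (sym (nSupersets-suc-0 (length xs) (count t xs))))
  by-mark false tx (suc k) rewrite tx =
    trans (cong₂ ℕ._+_ (count-supersets t u (suc k)) (count-supersets t u k))
          (sym (nSupersets-suc k (count-≤-length t xs)))

-- Edges induced on a set of vertices

count-cartesianProduct-skip : (p : A × B → Bool) (xs : List A) {y : B} (ys : List B) →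
  (∀ {x} → x ∈ xs → p (x , y) ≡ false) →
  count p (cartesianProduct xs (y ∷ ys)) ≡ count p (cartesianProduct xs ys)
count-cartesianProduct-skip p []       ys _  = refl
count-cartesianProduct-skip p (x ∷ xs) ys ¬p rewrite ¬p (here refl) = begin
  count p (map (x ,_) ys ++ cartesianProduct xs (_ ∷ ys))
    ≡⟨ count-++ p (map (x ,_) ys) _ ⟩
  count p (map (x ,_) ys) ℕ.+ count p (cartesianProduct xs (_ ∷ ys))
    ≡⟨ cong (count p (map (x ,_) ys) ℕ.+_) (count-cartesianProduct-skip p xs ys (¬p ∘ there)) ⟩
  count p (map (x ,_) ys) ℕ.+ count p (cartesianProduct xs ys)
    ≡⟨ count-++ p (map (x ,_) ys) _ ⟨
  count p (map (x ,_) ys ++ cartesianProduct xs ys) ∎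
  where open ≡-Reasoning

ordered : Edge n → Bool
ordered (i , j) = toℕ i <ᵇ toℕ j

ordered≡true : {i j : Fin n} → i Fin.< j → ordered (i , j) ≡ true
ordered≡true i<j = dec-true (_ ℕₚ.<? _) i<j

ordered≡false : {i j : Fin n} → ¬ (i Fin.< j) → ordered (i , j) ≡ false
ordered≡false i≮j = dec-false (_ ℕₚ.<? _) i≮j

ordered⇒< : {i j : Fin n} → ordered (i , j) ≡ true → i Fin.< j
ordered⇒< {i = i} {j} i<j = ℕₚ.<ᵇ⇒< (toℕ i) (toℕ j) (Equivalence.from T-≡ i<j)

count-orderedPairs : (s : Fin n → Bool) {L : List (Fin n)} → AllPairs Fin._<_ L →
  count (λ e → ordered e ∧ (s (proj₁ e) ∧ s (proj₂ e))) (cartesianProduct L L) ≡ count s L C 2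
count-orderedPairs s                           []   = refl
count-orderedPairs s {x ∷ xs} (x<xs ∷ sorted) = begin
  count R (cartesianProduct (x ∷ xs) (x ∷ xs))
    ≡⟨ cong (λ b → if b ∧ (s x ∧ s x) then suc (count R rest) else count R rest)
            (ordered≡false {i = x} {x} (ℕₚ.<-irrefl refl)) ⟩
  count R rest
    ≡⟨ count-++ R (map (x ,_) xs) _ ⟩
  count R (map (x ,_) xs) ℕ.+ count R (cartesianProduct xs (x ∷ xs))
    ≡⟨ cong₂ ℕ._+_ (count-map R (x ,_) xs) (count-cartesianProduct-skip R xs xs x≮) ⟩
  count (λ j → R (x , j)) xs ℕ.+ count R (cartesianProduct xs xs)
    ≡⟨ cong₂ ℕ._+_ (count-cong xs x<) (count-orderedPairs s sorted) ⟩
  count (λ j → s x ∧ s j) xs ℕ.+ count s xs C 2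
    ≡⟨ add-vertex (s x) ⟩
  count s (x ∷ xs) C 2 ∎
  where
  open ≡-Reasoning
  R = λ e → ordered e ∧ (s (proj₁ e) ∧ s (proj₂ e))
  rest = map (x ,_) xs ++ cartesianProduct xs (x ∷ xs)
  x≮ : ∀ {i} → i ∈ xs → R (i , x) ≡ false
  x≮ {i} i∈ = cong (_∧ (s i ∧ s x)) (ordered≡false (ℕₚ.<-asym (All.lookup x<xs i∈)))
  x< : ∀ {j} → j ∈ xs → R (x , j) ≡ (s x ∧ s j)
  x< {j} j∈ = cong (_∧ (s x ∧ s j)) (ordered≡true (All.lookup x<xs j∈))
  add-vertex : ∀ b → count (λ j → b ∧ s j) xs ℕ.+ count s xs C 2
                       ≡ (if b then suc (count s xs) else count s xs) C 2
  add-vertex true  = sym (suc-C2 (count s xs))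
  add-vertex false = cong (ℕ._+ count s xs C 2) (count-≡0 _ xs (λ _ → refl))

vertexPairs : (n : ℕ) → List (Edge n)
vertexPairs n = cartesianProduct (allFin n) (allFin n)

∈-vertexPairs : (i j : Fin n) → (i , j) ∈ vertexPairs n
∈-vertexPairs i j = ∈-cartesianProduct⁺ (∈-allFin i) (∈-allFin j)

inside : List (Fin n) → Edge n → Bool
inside S (i , j) = (i ∈ᵇ S) ∧ (j ∈ᵇ S)

isPairIn : List (Fin n) → Edge n → Bool
isPairIn S e = ordered e ∧ inside S e

isPairIn≡true : {S : List (Fin n)} {i j : Fin n} → i ∈ S → j ∈ S → i Fin.< j → isPairIn S (i , j) ≡ true
isPairIn≡true {S = S} i∈S j∈S i<j =
  cong₂ _∧_ (ordered≡true i<j) (cong₂ _∧_ (∈⇒∈ᵇ S i∈S) (∈⇒∈ᵇ S j∈S))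

count-isPairIn : {S : List (Fin n)} → S ⊆ allFin n → count (isPairIn S) (vertexPairs n) ≡ length S C 2
count-isPairIn {n} {S} S⊆ =
  trans (count-orderedPairs (_∈ᵇ S) (AllPairs.tabulate⁺-< (λ i<j → i<j)))
        (cong (_C 2) (count-∈ᵇ (Unique.allFin⁺ n) S⊆))

allᵇ²⇔isPairIn : (ρ : Fin n → Fin n → Bool) → (∀ i j → ρ i j ≡ ρ j i) → (∀ i → ρ i i ≡ true) →
  (S : List (Fin n)) → allᵇ (λ i → allᵇ (ρ i) S) S ≡ true
    ⇔ (∀ {e} → e ∈ vertexPairs n → isPairIn S e ≡ true → ρ (proj₁ e) (proj₂ e) ≡ true)
allᵇ²⇔isPairIn {n} ρ ρ-sym ρ-refl S = mk⇔ on-pairs on-all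
  where
  on-pairs : allᵇ (λ i → allᵇ (ρ i) S) S ≡ true →
             ∀ {e} → e ∈ vertexPairs n → isPairIn S e ≡ true → ρ (proj₁ e) (proj₂ e) ≡ true
  on-pairs all {i , j} _ pair with ∧≡true⇒ (proj₂ (∧≡true⇒ {ordered (i , j)} pair))
  ... | i∈S , j∈S =
    All.lookup (allᵇ⇒All (ρ i) S (All.lookup (allᵇ⇒All _ S all) (∈ᵇ⇒∈ S i∈S))) (∈ᵇ⇒∈ S j∈S)
  on-all : (∀ {e} → e ∈ vertexPairs n → isPairIn S e ≡ true → ρ (proj₁ e) (proj₂ e) ≡ true) →
           allᵇ (λ i → allᵇ (ρ i) S) S ≡ true
  on-all h = All⇒allᵇ _ S (All.tabulate λ i∈S → All⇒allᵇ _ S (All.tabulate λ j∈S → ρ-on i∈S j∈S))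
    where
    ρ-on : ∀ {i j} → i ∈ S → j ∈ S → ρ i j ≡ true
    ρ-on {i} {j} i∈S j∈S with ℕₚ.<-cmp (toℕ i) (toℕ j)
    ... | tri< i<j _ _ = h (∈-vertexPairs i j) (isPairIn≡true i∈S j∈S i<j)
    ... | tri≈ _ i≡j _ rewrite toℕ-injective i≡j = ρ-refl j
    ... | tri> _ _ j<i = trans (ρ-sym i j) (h (∈-vertexPairs j i) (isPairIn≡true j∈S i∈S j<i))

module _ (G : SimpleGraph n) where

  isEdge : Edge n → Bool
  isEdge (i , j) = adj G i j

  edgesWithin : List (Fin n) → List (Edge n)
  edgesWithin S = filterᵇ (inside S) (edges G)

  length-edgesWithin : (S : List (Fin n)) →
    length (edgesWithin S) ≡ count (λ e → isPairIn S e ∧ isEdge e) (vertexPairs n)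
  length-edgesWithin S = begin
    length (edgesWithin S)
      ≡⟨ length-filterᵇ (inside S) (edges G) ⟩
    count (inside S) (edges G)
      ≡⟨ count-filterᵇ _ (inside S) (vertexPairs n) ⟩
    count (λ e → (ordered e ∧ isEdge e) ∧ inside S e) (vertexPairs n)
      ≡⟨ count-cong (vertexPairs n) (λ {e} _ → xy∙z≈xz∙y (ordered e) (isEdge e) (inside S e)) ⟩
    count (λ e → isPairIn S e ∧ isEdge e) (vertexPairs n) ∎
    where
    open ≡-Reasoning
    open CommutativeSemigroupProperties (CommutativeMonoid.commutativeSemigroup ∧-commutativeMonoid)
      using (xy∙z≈xz∙y)

  edgesWithin-≤ : {S : List (Fin n)} → S ⊆ allFin n → length (edgesWithin S) ≤ length S C 2
  edgesWithin-≤ {S} S⊆ = subst₂ _≤_ (sym (length-edgesWithin S)) (count-isPairIn S⊆)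
                                (count-∧-≤ (isPairIn S) isEdge (vertexPairs n))

  isClique⇔ : (S : List (Fin n)) → isClique G S ≡ true
    ⇔ (∀ {e} → e ∈ vertexPairs n → isPairIn S e ≡ true → isEdge e ≡ true)
  isClique⇔ S = mk⇔ (λ cl {e} e∈ pair → trans (sym (ρ≡isEdge pair)) (Equivalence.to all⇔ cl e∈ pair))
                    (λ h → Equivalence.from all⇔ (λ {e} e∈ pair → trans (ρ≡isEdge pair) (h e∈ pair)))
    where
    ρ : Fin n → Fin n → Bool
    ρ i j = (i =ᵛ j) ∨ adj G i j
    all⇔ = allᵇ²⇔isPairIn ρ (λ i j → cong₂ _∨_ (=ᵛ-sym i j) (SimpleGraph.sym G i j))
                            (λ i → cong (_∨ adj G i i) (=ᵛ-refl i)) S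
    ρ≡isEdge : ∀ {e} → isPairIn S e ≡ true → ρ (proj₁ e) (proj₂ e) ≡ isEdge e
    ρ≡isEdge {i , j} pair = cong (_∨ adj G i j) (≢⇒=ᵛ-false {i = i} {j} λ { refl →
      ℕₚ.<-irrefl refl (ordered⇒< {i = i} {i} (proj₁ (∧≡true⇒ {ordered (i , i)} pair))) })

  isIndep⇔ : (S : List (Fin n)) → isIndep G S ≡ true
    ⇔ (∀ {e} → e ∈ vertexPairs n → isPairIn S e ≡ true → isEdge e ≡ false)
  isIndep⇔ S = mk⇔ (λ ind {e} e∈ pair → not-injective (Equivalence.to all⇔ ind e∈ pair))
                   (λ h → Equivalence.from all⇔ (λ {e} e∈ pair → cong not (h e∈ pair)))
    where
    all⇔ = allᵇ²⇔isPairIn (λ i j → not (adj G i j)) (λ i j → cong not (SimpleGraph.sym G i j))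
                           (λ i → cong not (irrefl G i)) S

  isClique≡ : {S : List (Fin n)} → S ⊆ allFin n →
    isClique G S ≡ (length (edgesWithin S) ≡ᵇ length S C 2)
  isClique≡ {S} S⊆ = ⇔→≡ (mk⇔ to from)
    where
    counts⇔ = count-∧≡count⇔ (isPairIn S) isEdge (vertexPairs n)
    to : isClique G S ≡ true → (length (edgesWithin S) ≡ᵇ length S C 2) ≡ true
    to cl = dec-true (_ ℕₚ.≟ _) (trans (length-edgesWithin S)
              (trans (Equivalence.from counts⇔ (Equivalence.to (isClique⇔ S) cl)) (count-isPairIn S⊆)))
    from : (length (edgesWithin S) ≡ᵇ length S C 2) ≡ true → isClique G S ≡ true
    from eq = Equivalence.from (isClique⇔ S) (Equivalence.to counts⇔
                (trans (sym (length-edgesWithin S)) (trans (≡ᵇ⇒≡ eq) (sym (count-isPairIn S⊆)))))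

  isIndep≡ : (S : List (Fin n)) → isIndep G S ≡ (length (edgesWithin S) ≡ᵇ 0)
  isIndep≡ S = ⇔→≡ (mk⇔ to from)
    where
    count⇔ = count-∧≡0⇔ (isPairIn S) isEdge (vertexPairs n)
    to : isIndep G S ≡ true → (length (edgesWithin S) ≡ᵇ 0) ≡ true
    to ind = dec-true (_ ℕₚ.≟ 0)
               (trans (length-edgesWithin S) (Equivalence.from count⇔ (Equivalence.to (isIndep⇔ S) ind)))
    from : (length (edgesWithin S) ≡ᵇ 0) ≡ true → isIndep G S ≡ true
    from eq = Equivalence.from (isIndep⇔ S)
                (Equivalence.to count⇔ (trans (sym (length-edgesWithin S)) (≡ᵇ⇒≡ eq)))

-- Double counting

isEffective : List (Edge n) → Fin n → Bool
isEffective H v = anyᵇ (λ e → (proj₁ e =ᵛ v) ∨ (proj₂ e =ᵛ v)) H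

effectiveWithin : List (Edge n) → List (Fin n) → Bool
effectiveWithin {n} H S = containsMarked (isEffective H) (allFin n) S

endpoints-isEffective : {H : List (Edge n)} {e : Edge n} → e ∈ H →
  isEffective H (proj₁ e) ≡ true × isEffective H (proj₂ e) ≡ true
endpoints-isEffective {H = H} {i , j} e∈H =
  Any⇒anyᵇ _ H (Any.map (λ { refl → cong (_∨ (j =ᵛ i)) (=ᵛ-refl i) }) e∈H) ,
  Any⇒anyᵇ _ H (Any.map (λ { refl → trans (cong ((i =ᵛ j) ∨_) (=ᵛ-refl j)) (∨-zeroʳ _) }) e∈H)

effectiveWithin≡allᵇ-inside : (H : List (Edge n)) (S : List (Fin n)) → effectiveWithin H S ≡ allᵇ (inside S) H
effectiveWithin≡allᵇ-inside {n} H S = ⇔→≡ (mk⇔ to from)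
  where
  to : effectiveWithin H S ≡ true → allᵇ (inside S) H ≡ true
  to covered = All⇒allᵇ (inside S) H (All.tabulate λ e∈H →
      cong₂ _∧_ (effective⇒∈ᵇ (proj₁ (endpoints-isEffective e∈H)))
                (effective⇒∈ᵇ (proj₂ (endpoints-isEffective e∈H))))
    where
    effective⇒∈ᵇ : ∀ {v} → isEffective H v ≡ true → (v ∈ᵇ S) ≡ true
    effective⇒∈ᵇ {v} eff =
      subst (λ b → (not b ∨ (v ∈ᵇ S)) ≡ true) eff
            (All.lookup (allᵇ⇒All _ (allFin n) covered) (∈-allFin v))
  from : allᵇ (inside S) H ≡ true → effectiveWithin H S ≡ true
  from all-inside = All⇒allᵇ _ (allFin n) (All.tabulate λ {v} _ → covered v)
    where
    endpoint∈ᵇ : ∀ {e v} → inside S e ≡ true × ((proj₁ e =ᵛ v) ∨ (proj₂ e =ᵛ v)) ≡ true →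
                 (v ∈ᵇ S) ≡ true
    endpoint∈ᵇ {i , j} {v} (e-inside , incident)
      with ∧≡true⇒ {i ∈ᵇ S} e-inside | ∨≡true⇒ {i =ᵛ v} incident
    ... | i∈S , _ | inj₁ i=v = subst (λ u → (u ∈ᵇ S) ≡ true) (=ᵛ⇒≡ i=v) i∈S
    ... | _ , j∈S | inj₂ j=v = subst (λ u → (u ∈ᵇ S) ≡ true) (=ᵛ⇒≡ j=v) j∈S
    covered : ∀ v → (not (isEffective H v) ∨ (v ∈ᵇ S)) ≡ true
    covered v with isEffective H v in eff
    ... | false = refl
    ... | true  = endpoint∈ᵇ (All.lookupAny (allᵇ⇒All (inside S) H all-inside) (anyᵇ⇒Any _ H eff))

module DoubleCounting (G : SimpleGraph n) (k : ℕ) where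

  K : ℕ
  K = k C 2

  vertexSets : List (List (Fin n))
  vertexSets = sublists (allFin n)

  edgeSets : List (List (Edge n))
  edgeSets = sublists (edges G)

  weight : List (Edge n) → ℤ
  weight = truncatedSign K ∘ length

  term : List (Fin n) → List (Edge n) → ℤ
  term S H = if (length S ≡ᵇ k) ∧ effectiveWithin H S then weight H else 0ℤ

  binomial : ℕ → ℕ
  binomial b = (n ∸ b) C (k ∸ b)

  rhsSummand : ℕ → ℕ → List (Edge n) → ℤ
  rhsSummand a b H = if (length H ≡ᵇ a) ∧ (numEff H ≡ᵇ b) then sign a * + binomial b else 0ℤ

  signed-φ≡∑ : ∀ a b → sign a * + (binomial b ℕ.* φ a b G) ≡ ∑ (rhsSummand a b) edgeSets
  signed-φ≡∑ a b = begin
    sign a * + (binomial b ℕ.* φ a b G)   ≡⟨ cong (sign a *_) (ℤₚ.pos-* (binomial b) (φ a b G)) ⟩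
    sign a * (+ binomial b * + φ a b G)   ≡⟨ ℤₚ.*-assoc (sign a) (+ binomial b) _ ⟨
    sign a * + binomial b * + φ a b G     ≡⟨ ∑-count (sign a * + binomial b) _ edgeSets ⟨
    ∑ (rhsSummand a b) edgeSets           ∎
    where open ≡-Reasoning

  count-effectiveWithin : ∀ H →
    count (λ S → (length S ≡ᵇ k) ∧ effectiveWithin H S) vertexSets ≡ nSupersets n (numEff H) k
  count-effectiveWithin H =
    trans (count-supersets (isEffective H) (Unique.allFin⁺ n) k)
          (cong (λ m → nSupersets m (numEff H) k) (length-tabulate (λ i → i)))

  ∑-rhsSummand≡∑-term : ∀ H →
    ∑ (λ a → ∑ (λ b → rhsSummand a b H) (upTo (suc k))) (upTo K) ≡ ∑ (λ S → term S H) vertexSets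
  ∑-rhsSummand≡∑-term H = begin
    ∑ (λ a → ∑ (λ b → rhsSummand a b H) (upTo (suc k))) (upTo K)
      ≡⟨ ∑-upTo-select₂ K (suc k) ℓ b (λ a b → sign a * + binomial b) ⟩
    (if ℓ <ᵇ K then (if b <ᵇ suc k then sign ℓ * + binomial b else 0ℤ) else 0ℤ)
      ≡⟨ nested-if≡product (ℓ <ᵇ K) (b <ᵇ suc k) (sign ℓ) (binomial b) ⟩
    weight H * + nSupersets n b k
      ≡⟨ cong (λ m → weight H * + m) (count-effectiveWithin H) ⟨
    weight H * + count (λ S → (length S ≡ᵇ k) ∧ effectiveWithin H S) vertexSets
      ≡⟨ ∑-count (weight H) _ vertexSets ⟨
    ∑ (λ S → term S H) vertexSets ∎
    where
    open ≡-Reasoning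
    ℓ = length H
    b = numEff H

  rhs≡∑∑ : rhs k G ≡ ∑ (λ H → ∑ (λ S → term S H) vertexSets) edgeSets
  rhs≡∑∑ = begin
    rhs k G
      ≡⟨ ∑-cong (upTo K) (λ {a} _ → ∑-cong (upTo (suc k)) (λ {b} _ → signed-φ≡∑ a b)) ⟩
    ∑ (λ a → ∑ (λ b → ∑ (rhsSummand a b) edgeSets) (upTo (suc k))) (upTo K)
      ≡⟨ ∑-cong (upTo K) (λ {a} _ → ∑-comm (rhsSummand a) (upTo (suc k)) edgeSets) ⟩
    ∑ (λ a → ∑ (λ H → ∑ (λ b → rhsSummand a b H) (upTo (suc k))) edgeSets) (upTo K)
      ≡⟨ ∑-comm (λ a H → ∑ (λ b → rhsSummand a b H) (upTo (suc k))) (upTo K) edgeSets ⟩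
    ∑ (λ H → ∑ (λ a → ∑ (λ b → rhsSummand a b H) (upTo (suc k))) (upTo K)) edgeSets
      ≡⟨ ∑-cong edgeSets (λ {H} _ → ∑-rhsSummand≡∑-term H) ⟩
    ∑ (λ H → ∑ (λ S → term S H) vertexSets) edgeSets ∎
    where open ≡-Reasoning

  ∑-effectiveWithin≡cliqueOrIndep : sign K ≡ -1ℤ → {S : List (Fin n)} → S ⊆ allFin n → length S ≡ k →
    ∑ (λ H → if effectiveWithin H S then weight H else 0ℤ) edgeSets
      ≡ (if isClique G S ∨ isIndep G S then 1ℤ else 0ℤ)
  ∑-effectiveWithin≡cliqueOrIndep odd {S} S⊆ |S|≡k = begin
    ∑ (λ H → if effectiveWithin H S then weight H else 0ℤ) edgeSets
      ≡⟨ ∑-cong edgeSets (λ {H} _ → cong (λ b → if b then weight H else 0ℤ)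
                                          (effectiveWithin≡allᵇ-inside H S)) ⟩
    ∑ (λ H → if allᵇ (inside S) H then weight H else 0ℤ) edgeSets
      ≡⟨ ∑-sublists-filterᵇ (inside S) weight (edges G) ⟩
    ∑ weight (sublists (edgesWithin G S))
      ≡⟨ ∑-sublists-truncatedSign K (edgesWithin G S) ⟩
    alternating K e
      ≡⟨ alternating-odd odd (subst (λ m → e ≤ m C 2) |S|≡k (edgesWithin-≤ G S⊆)) ⟩
    (if (e ≡ᵇ K) ∨ (e ≡ᵇ 0) then 1ℤ else 0ℤ)
      ≡⟨ cong₂ (λ c d → if c ∨ d then 1ℤ else 0ℤ) (sym clique≡) (sym (isIndep≡ G S)) ⟩
    (if isClique G S ∨ isIndep G S then 1ℤ else 0ℤ) ∎
    where
    open ≡-Reasoning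
    e = length (edgesWithin G S)
    clique≡ : isClique G S ≡ (e ≡ᵇ K)
    clique≡ = subst (λ m → isClique G S ≡ (e ≡ᵇ m C 2)) |S|≡k (isClique≡ G S⊆)

  ∑-term≡cliqueOrIndep : sign K ≡ -1ℤ → {S : List (Fin n)} → S ∈ vertexSets →
    ∑ (term S) edgeSets ≡ (if (length S ≡ᵇ k) ∧ (isClique G S ∨ isIndep G S) then 1ℤ else 0ℤ)
  ∑-term≡cliqueOrIndep odd {S} S∈ =
    trans (∑-guard (length S ≡ᵇ k) _ weight edgeSets) (by-size (length S ≡ᵇ k) refl)
    where
    by-size : ∀ b → (length S ≡ᵇ k) ≡ b →
      (if b then ∑ (λ H → if effectiveWithin H S then weight H else 0ℤ) edgeSets else 0ℤ)
        ≡ (if b ∧ (isClique G S ∨ isIndep G S) then 1ℤ else 0ℤ)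
    by-size false _     = refl
    by-size true  |S|≡k =
      ∑-effectiveWithin≡cliqueOrIndep odd (∈-sublists⇒⊆ (allFin n) S∈) (≡ᵇ⇒≡ |S|≡k)

  Φ≡∑∑ : sign K ≡ -1ℤ → + Φ k G ≡ ∑ (λ S → ∑ (term S) edgeSets) vertexSets
  Φ≡∑∑ odd = begin
    + Φ k G
      ≡⟨ ℤₚ.*-identityˡ _ ⟨
    1ℤ * + Φ k G
      ≡⟨ ∑-count 1ℤ _ vertexSets ⟨
    ∑ (λ S → if (length S ≡ᵇ k) ∧ (isClique G S ∨ isIndep G S) then 1ℤ else 0ℤ) vertexSets
      ≡⟨ ∑-cong vertexSets (λ S∈ → sym (∑-term≡cliqueOrIndep odd S∈)) ⟩
    ∑ (λ S → ∑ (term S) edgeSets) vertexSets ∎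
    where open ≡-Reasoning

proposition5p5 : (n k : ℕ) → 2 ≤ k → k ≤ n → (k % 4 ≡ 2 ⊎ k % 4 ≡ 3) →
    (G : SimpleGraph n) → + (Φ k G) ≡ rhs k G
proposition5p5 n k _ _ k%4 G = begin
  + Φ k G                                            ≡⟨ Φ≡∑∑ (sign-C2 k k%4) ⟩
  ∑ (λ S → ∑ (term S) edgeSets) vertexSets           ≡⟨ ∑-comm term vertexSets edgeSets ⟩
  ∑ (λ H → ∑ (λ S → term S H) vertexSets) edgeSets   ≡⟨ rhs≡∑∑ ⟨
  rhs k G                                            ∎
  where
  open ≡-Reasoning
  open DoubleCounting G k
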